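{- Let $\mathcal{V}$ be a variety of associative po-groupoids. The following are equivalent: (1) $\mathcal{V}\models\forall x,y,z\,(x\preceq z\wedge y\preceq z\rightarrow x\cdot y=y\cdot x)$; (2) $\mathcal{V}\models x\cdot y\cdot z\approx y\cdot x\cdot z$.
   Context: A po-groupoid is a groupoid $\langle A,\cdot\rangle$ such that $x\preceq y :\iff x\cdot y=x$ is a partial order on $A$. A variety of po-groupoids is a variety with a binary term $\cdot$ such that every member is a po-groupoid under $\cdot$; it is a variety of associative po-groupoids if moreover $\cdot$ is associative in every member (so $x\cdot y\cdot z$ is unambiguous). -}

module Defs where

open import Level using (Level; _⊔_) renaming (suc to lsuc; zero to lzero)
open import Data.Nat using (ℕ)
open import Data.Fin using (Fin; zero; suc)
open import Data.Product using (_×_)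
open import Relation.Binary.PropositionalEquality using (_≡_)
open import Relation.Binary.Structures using (IsPartialOrder)
open import Algebra.Definitions using (Associative)

record Signature : Set₁ where
  field
    Op    : Set
    arity : Op → ℕ
open Signature public

record Algebra (a : Level) (S : Signature) : Set (lsuc a) where
  field
    Carrier : Set a
    ops     : (f : Op S) → (Fin (arity S f) → Carrier) → Carrier
open Algebra public

data Term (S : Signature) (X : Set) : Set where
  var : X → Term S X
  op  : (f : Op S) → (Fin (arity S f) → Term S X) → Term S X

⟦_⟧ : ∀ {a S X} → Term S X → (A : Algebra a S) → (X → Carrier A) → Carrier A
⟦ var x  ⟧ A ρ = ρ x
⟦ op f ts ⟧ A ρ = ops A f (λ i → ⟦ ts i ⟧ A ρ)

Identities : Signature → Set₁
Identities S = Term S ℕ × Term S ℕ → Set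

-- A ⊨ E : A satisfies every identity of E (A belongs to the variety Mod(E)).
_⊨_ : ∀ {a S} → Algebra a S → Identities S → Set a
A ⊨ E = ∀ {s t} → E (s Data.Product., t) → (ρ : ℕ → Carrier A) → ⟦ s ⟧ A ρ ≡ ⟦ t ⟧ A ρ

binop : ∀ {a S} → Term S (Fin 2) → (A : Algebra a S) → Carrier A → Carrier A → Carrier A
binop t A x y = ⟦ t ⟧ A (λ { zero → x ; (suc zero) → y })

IsAssocPoGroupoid : ∀ {a S} → Term S (Fin 2) → Algebra a S → Set a
IsAssocPoGroupoid t A =
  IsPartialOrder _≡_ (λ x y → binop t A x y ≡ x) × Associative _≡_ (binop t A)

Cond1 : ∀ {a S} → Term S (Fin 2) → Algebra a S → Set a
Cond1 t A = ∀ x y z → binop t A x z ≡ x → binop t A y z ≡ y →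
            binop t A x y ≡ binop t A y x

Cond2 : ∀ {a S} → Term S (Fin 2) → Algebra a S → Set a
Cond2 t A = ∀ x y z → binop t A (binop t A x y) z ≡ binop t A (binop t A y x) z

-- Both conditions concern a single member, and reflexivity of ⪯ makes every
-- associative po-groupoid a band, so the equivalence holds in each band.
-- The key point for (1) ⇒ (2) is that u·z ⪯ z for every u, so (1) applies to
-- x·z and y·z below the common bound z.
module Submission where

open import Defs
open import Level using (Level)
open import Data.Fin using (Fin)
open import Data.Product using (_,_)
open import Function.Bundles using (_⇔_; mk⇔; module Equivalence)
open import Relation.Binary.PropositionalEquality
open import Relation.Binary.Structures using (IsPartialOrder)
import Algebra.Definitions as Definitions

module Band {a} {C : Set a} (_·_ : C → C → C)
            (idem : Definitions.Idempotent {A = C} _≡_ _·_)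
            (assoc : Definitions.Associative {A = C} _≡_ _·_) where

  CommutesBelowCommonBound : Set a
  CommutesBelowCommonBound =
    ∀ x y z → x · z ≡ x → y · z ≡ y → x · y ≡ y · x

  LeftNormal : Set a
  LeftNormal = ∀ x y z → (x · y) · z ≡ (y · x) · z

  ·-below-right : ∀ x z → (x · z) · z ≡ x · z
  ·-below-right x z = trans (assoc x z z) (cong (x ·_) (idem z))

  commutesBelowCommonBound⇒leftNormal : CommutesBelowCommonBound → LeftNormal
  commutesBelowCommonBound⇒leftNormal comm x y z =
    begin
      (x · y) · z        ≡⟨ assoc x y z ⟩
      x · (y · z)        ≡⟨ cong (x ·_) (absorb y) ⟩
      x · (z · (y · z))  ≡⟨ assoc x z (y · z) ⟨
      (x · z) · (y · z)  ≡⟨ comm (x · z) (y · z) z (·-below-right x z) (·-below-right y z) ⟩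
      (y · z) · (x · z)  ≡⟨ assoc y z (x · z) ⟩
      y · (z · (x · z))  ≡⟨ cong (y ·_) (absorb x) ⟨
      y · (x · z)        ≡⟨ assoc y x z ⟨
      (y · x) · z        ∎
    where
    open ≡-Reasoning
    absorb : ∀ u → u · z ≡ z · (u · z)
    absorb u = trans (sym (·-below-right u z))
                     (comm (u · z) z z (·-below-right u z) (idem z))

  leftNormal⇒commutesBelowCommonBound : LeftNormal → CommutesBelowCommonBound
  leftNormal⇒commutesBelowCommonBound normal x y z xz≡x yz≡y =
    begin
      x · y              ≡⟨ cong (x ·_) yz≡y ⟨
      x · (y · z)        ≡⟨ assoc x y z ⟨
      (x · y) · z        ≡⟨ normal x y z ⟩
      (y · x) · z        ≡⟨ assoc y x z ⟩
      y · (x · z)        ≡⟨ cong (y ·_) xz≡x ⟩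
      y · x              ∎
    where open ≡-Reasoning

  commutesBelowCommonBound⇔leftNormal : CommutesBelowCommonBound ⇔ LeftNormal
  commutesBelowCommonBound⇔leftNormal =
    mk⇔ commutesBelowCommonBound⇒leftNormal leftNormal⇒commutesBelowCommonBound

cond1⇔cond2 : ∀ {a S} (t : Term S (Fin 2)) (A : Algebra a S) →
              IsAssocPoGroupoid t A → Cond1 t A ⇔ Cond2 t A
cond1⇔cond2 t A (isPartialOrder , assoc) =
  Band.commutesBelowCommonBound⇔leftNormal (binop t A) idem assoc
  where
  idem : Definitions.Idempotent _≡_ (binop t A)
  idem x = IsPartialOrder.reflexive isPartialOrder refl

lemma3p1 : ∀ {a : Level} (S : Signature) (E : Identities S) (t : Term S (Fin 2)) →
           (∀ (A : Algebra a S) → A ⊨ E → IsAssocPoGroupoid t A) →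
           ((∀ (A : Algebra a S) → A ⊨ E → Cond1 t A) ⇔
            (∀ (A : Algebra a S) → A ⊨ E → Cond2 t A))
lemma3p1 S E t isPoGroupoid = mk⇔
  (λ cond1 A (A⊨E : A ⊨ E) → to   (cond1⇔cond2 t A (isPoGroupoid A A⊨E)) (cond1 A A⊨E))
  (λ cond2 A (A⊨E : A ⊨ E) → from (cond1⇔cond2 t A (isPoGroupoid A A⊨E)) (cond2 A A⊨E))
  where open Equivalence
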